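{- Let $q>2$ be an odd integer and write $f(n)=f_{2,q}(n)$. For all integers $t\ge0$ and $n\ge1$, $$f(n+1)-f(n)=f_{\overline{\{1,2,2^2,\dots,2^t\}}}(n+1)-f_{\{1,2,2^2,\dots,2^t\}}(n).$$
   Context: $\mathbb{N}$ denotes the set of nonnegative integers and $q>2$ is a fixed odd integer. An expression of $n$ is a representation $n=\sum 2^{\alpha}q^{\beta}$ as a sum of distinct terms from $\{2^{\alpha}q^{\beta}:\alpha,\beta\in\mathbb{N}\}$ (equivalently, a finite subset of this set with sum $n$). $f_{2,q}(n)$ is the number of expressions of $n$. For a subset $\mathcal{A}\subset\mathbb{N}$, $f_{\mathcal{A}}(n)$ is the number of expressions of $n$ in which every element of $\mathcal{A}$ occurs as a term; for $\mathcal{B}\subset\mathbb{N}$, $f_{\overline{\mathcal{B}}}(n)$ is the number of expressions of $n$ in which no element of $\mathcal{B}$ occurs as a term. -}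

module Defs where

open import Data.Nat using (ℕ; zero; suc; _+_; _*_; _^_; _≤?_; _≟_)
open import Data.Nat.Properties using (≡-decSetoid)
open import Data.List using (List; []; _∷_; map; _++_; concatMap; filter; upTo; deduplicate)
open import Data.Bool.ListAction using (all; any)
open import Data.Nat.ListAction using (sum)
open import Data.Bool using (Bool; true; false; _∧_; not)
open import Relation.Nullary.Decidable using (⌊_⌋)

-- The set of admissible terms {2^α q^β : α, β ∈ ℕ} that are ≤ n,
-- listed without repetition.  (If 2^α q^β ≤ n then α ≤ n and β ≤ n.)
terms : ℕ → ℕ → List ℕ
terms q n =
  deduplicate _≟_
    (filter (λ m → m ≤? n)
      (concatMap (λ a → map (λ b → 2 ^ a * q ^ b) (upTo (suc n))) (upTo (suc n))))

sublists : {A : Set} → List A → List (List A)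
sublists [] = [] ∷ []
sublists (x ∷ xs) = map (x ∷_) (sublists xs) ++ sublists xs

countB : {A : Set} → (A → Bool) → List A → ℕ
countB p [] = 0
countB p (x ∷ xs) with p x
... | true  = suc (countB p xs)
... | false = countB p xs

_∈ᵇ_ : ℕ → List ℕ → Bool
m ∈ᵇ xs = any (λ x → ⌊ m ≟ x ⌋) xs

fWith : ℕ → (List ℕ → Bool) → ℕ → ℕ
fWith q p n = countB (λ s → ⌊ sum s ≟ n ⌋ ∧ p s) (sublists (terms q n))

f : ℕ → ℕ → ℕ
f q n = fWith q (λ _ → true) n

powers2 : ℕ → List ℕ
powers2 t = map (2 ^_) (upTo (suc t))

fIncl : ℕ → List ℕ → ℕ → ℕ
fIncl q A n = fWith q (λ s → all (λ a → a ∈ᵇ s) A) n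

fExcl : ℕ → List ℕ → ℕ → ℕ
fExcl q B n = fWith q (λ s → all (λ b → not (b ∈ᵇ s)) B) n

{-# OPTIONS --safe #-}
-- Write Pₖ = {1, 2, …, 2^(k−1)}. By induction on k,
--   f(n+1) + f_{Pₖ}(n) = f(n) + f_{¬Pₖ}(n+1).
-- Splitting according to whether 2^k is a term,
--   f_{Pₖ}(n)      = f_{Pₖ₊₁}(n)      + #{expressions of n containing Pₖ but not 2^k},
--   f_{¬Pₖ}(n+1)   = f_{¬Pₖ₊₁}(n+1)   + #{expressions of n+1 containing 2^k but no element of Pₖ},
-- and the two new counts agree: as 2^k = 1 + (1 + 2 + ⋯ + 2^(k−1)), replacing the term 2^k by the
-- terms of Pₖ is a bijection between these expressions. The case k = t + 1 is the theorem.
-- All counts are numbers of subsets of one finite set of terms, those ≤ 2^t + n, and the bijection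
-- is the symmetric difference with Pₖ ∪ {2^k}, an instance of a duality that swaps required and
-- forbidden elements.
module Submission where

open import Defs
open import Data.Nat
  using (ℕ; zero; suc; _+_; _*_; _^_; _≤_; _<_; _≟_; z≤n; s≤s; z<s; NonZero; >-nonZero; _≤′_; ≤′-refl; ≤′-step)
open import Data.Bool using (Bool; true; false; T; _∧_; not)
open import Data.Unit using (tt)
open import Data.Bool.Properties using (∧-zeroʳ)
open import Data.Bool.ListAction using (all; and)
open import Data.List using (List; []; _∷_; [_]; _++_; _∷ʳ_; map; concatMap; filter; upTo; deduplicate)
open import Data.List.Properties
  using (map-cong-local; map-++; filter-++; filter-none; filter-all; filter-reject; concatMap-++; concatMap-cong;
         concatMap-map; concatMap-pure; ++-identityʳ; upTo-∷ʳ)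
open import Data.List.Relation.Unary.All as All using (All; []; _∷_)
open import Data.List.Relation.Unary.All.Properties as AllP using (all-filter)
open import Data.List.Relation.Unary.Unique.Propositional using (Unique)
open import Data.List.Relation.Unary.AllPairs using ([]; _∷_)
open import Data.List.Relation.Unary.Unique.DecPropositional.Properties _≟_ using (deduplicate-!)
open import Data.List.Membership.Propositional using (_∈_; _∉_; lose)
open import Data.List.Membership.Propositional.Properties
  using (∈-deduplicate⁺; ∈-filter⁺; ∈-concatMap⁺; ∈-map⁺; ∈-map⁻; ∈-upTo⁺; ∈-upTo⁻; ∈-++⁺ˡ; ∈-++⁺ʳ; ∈-++⁻)
open import Data.List.Membership.DecPropositional _≟_ using (_∈?_)
open import Data.List.Relation.Binary.Subset.Propositional using (_⊆_)
open import Data.List.Relation.Unary.Any using (here; there)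
open import Data.Nat.Properties
open import Data.Nat.ListAction using (sum)
open import Data.Nat.Tactic.RingSolver using (solve-∀)
open import Algebra.Properties.CommutativeSemigroup +-commutativeSemigroup
  using () renaming (interchange to +-interchange; x∙yz≈y∙xz to +-exchange)
open import Function using (_∘_; case_of_)
import Data.Integer as ℤ
open import Data.Integer using (_⊖_)
open import Data.Integer.Properties using ([+m]-[+n]≡m⊖n; +-cancelˡ-⊖)
open import Data.Nat.Divisibility using (_∣_)
open import Data.Product using (_,_; _×_; ∃-syntax)
open import Data.Sum using (inj₁; inj₂; [_,_]′)
open import Data.Empty using (⊥-elim)
open import Level using (0ℓ)
open import Relation.Binary.Definitions using (DecidableEquality)
open import Relation.Binary.PropositionalEquality hiding ([_])
open import Relation.Nullary using (¬_; ¬?; yes; no; does)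
open import Relation.Nullary.Decidable using (⌊_⌋)
open import Relation.Unary using (Pred; Decidable; ∁)

private
  variable
    A B : Set

n<m^n : ∀ {m} → 1 < m → ∀ n → n < m ^ n
n<m^n 1<m zero = z<s
n<m^n {m} 1<m (suc n) = ≤-<-trans (n<m^n 1<m n) (^-monoʳ-< m 1<m (n<1+n n))

module _ {a p} {A : Set a} {P : Pred A p} (P? : Decidable P) where

  filter-comm : ∀ {q} {Q : Pred A q} (Q? : Decidable Q) xs →
                filter P? (filter Q? xs) ≡ filter Q? (filter P? xs)
  filter-comm Q? [] = refl
  filter-comm Q? (x ∷ xs) with does (P? x) in px | does (Q? x) in qx
  ... | true  | true  rewrite px | qx = cong (x ∷_) (filter-comm Q? xs)
  ... | true  | false rewrite qx = filter-comm Q? xs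
  ... | false | true  rewrite px = filter-comm Q? xs
  ... | false | false = filter-comm Q? xs

  filter-filter-⊆ : ∀ {q} {Q : Pred A q} (Q? : Decidable Q) → (∀ {x} → P x → Q x) → ∀ xs →
                    filter P? (filter Q? xs) ≡ filter P? xs
  filter-filter-⊆ Q? P⊆Q [] = refl
  filter-filter-⊆ Q? P⊆Q (x ∷ xs) with Q? x
  ... | no ¬qx = trans (filter-filter-⊆ Q? P⊆Q xs) (sym (filter-reject P? (¬qx ∘ P⊆Q)))
  ... | yes _ with P? x
  ...   | yes _ = cong (x ∷_) (filter-filter-⊆ Q? P⊆Q xs)
  ...   | no _  = filter-filter-⊆ Q? P⊆Q xs

  filter-deduplicate : (_≟ᴬ_ : DecidableEquality A) → ∀ xs →
                       filter P? (deduplicate _≟ᴬ_ xs) ≡ deduplicate _≟ᴬ_ (filter P? xs)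
  filter-deduplicate _≟ᴬ_ [] = refl
  filter-deduplicate _≟ᴬ_ (x ∷ xs) with P? x
  ... | yes _  = cong (x ∷_) (trans (filter-comm x≢? (deduplicate _≟ᴬ_ xs))
                                     (cong (filter x≢?) (filter-deduplicate _≟ᴬ_ xs)))
    where x≢? = ¬? ∘ (x ≟ᴬ_)
  ... | no ¬px = trans (filter-comm x≢? (deduplicate _≟ᴬ_ xs)) (trans (cong (filter x≢?) (filter-deduplicate _≟ᴬ_ xs))
                   (filter-all x≢? (All.map (λ px x≡y → ¬px (subst P (sym x≡y) px))
                                            (AllP.deduplicate⁺ _≟ᴬ_ (all-filter P? xs)))))
    where x≢? = ¬? ∘ (x ≟ᴬ_)

  filter-concatMap : ∀ {b} {B : Set b} (h : B → List A) xs →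
                     filter P? (concatMap h xs) ≡ concatMap (filter P? ∘ h) xs
  filter-concatMap h [] = refl
  filter-concatMap h (x ∷ xs) = trans (filter-++ P? (h x) (concatMap h xs)) (cong (filter P? (h x) ++_) (filter-concatMap h xs))

  filter-concatMap-upTo : ∀ (h : ℕ → List A) {j k} → (∀ {i} → j ≤ i → All (∁ P) (h i)) → j ≤ k →
                          filter P? (concatMap h (upTo k)) ≡ filter P? (concatMap h (upTo j))
  filter-concatMap-upTo h {j} rejected j≤k = go (≤⇒≤′ j≤k)
    where
    open ≡-Reasoning
    go : ∀ {k} → j ≤′ k → filter P? (concatMap h (upTo k)) ≡ filter P? (concatMap h (upTo j))
    go ≤′-refl = refl
    go (≤′-step {k} j≤′k) = begin
      filter P? (concatMap h (upTo (suc k)))           ≡⟨ cong (filter P? ∘ concatMap h) (upTo-∷ʳ k) ⟨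
      filter P? (concatMap h (upTo k ++ [ k ]))        ≡⟨ cong (filter P?) (concatMap-++ h (upTo k) [ k ]) ⟩
      filter P? (concatMap h (upTo k) ++ (h k ++ []))  ≡⟨ filter-++ P? (concatMap h (upTo k)) (h k ++ []) ⟩
      filter P? (concatMap h (upTo k)) ++ filter P? (h k ++ [])
        ≡⟨ cong (filter P? (concatMap h (upTo k)) ++_) (filter-none P? (AllP.++⁺ (rejected (≤′⇒≤ j≤′k)) [])) ⟩
      filter P? (concatMap h (upTo k)) ++ []           ≡⟨ ++-identityʳ _ ⟩
      filter P? (concatMap h (upTo k))                 ≡⟨ go j≤′k ⟩
      filter P? (concatMap h (upTo j))                 ∎

  filter-map-upTo : ∀ (g : ℕ → A) {j k} → (∀ {i} → j ≤ i → ¬ P (g i)) → j ≤ k →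
                    filter P? (map g (upTo k)) ≡ filter P? (map g (upTo j))
  filter-map-upTo g {j} {k} rejected j≤k = begin
      filter P? (map g (upTo k))                 ≡⟨ cong (filter P?) (map-as-concatMap (upTo k)) ⟩
      filter P? (concatMap ([_] ∘ g) (upTo k))   ≡⟨ filter-concatMap-upTo ([_] ∘ g) (λ j≤i → rejected j≤i ∷ []) j≤k ⟩
      filter P? (concatMap ([_] ∘ g) (upTo j))   ≡⟨ cong (filter P?) (map-as-concatMap (upTo j)) ⟨
      filter P? (map g (upTo j))                 ∎
    where
    open ≡-Reasoning
    map-as-concatMap : ∀ xs → map g xs ≡ concatMap ([_] ∘ g) xs
    map-as-concatMap xs = trans (sym (concatMap-pure (map g xs))) (concatMap-map [_] g xs)

-- The terms 2^a q^b below a bound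

module Terms (q : ℕ) (1<q : 1 < q) where

  instance
    q≢0 : NonZero q
    q≢0 = >-nonZero (<-trans z<s 1<q)

  term : ℕ → ℕ → ℕ
  term a b = 2 ^ a * q ^ b

  row : ℕ → ℕ → List ℕ
  row k a = map (term a) (upTo k)

  grid : ℕ → List ℕ
  grid k = concatMap (row k) (upTo k)

  <-termˡ : ∀ a b → a < term a b
  <-termˡ a b = <-≤-trans (n<m^n (s≤s (s≤s z≤n)) a) (m≤m*n (2 ^ a) (q ^ b) {{m^n≢0 q b}})

  <-termʳ : ∀ a b → b < term a b
  <-termʳ a b = <-≤-trans (n<m^n 1<q b) (m≤n*m (q ^ b) (2 ^ a) {{m^n≢0 2 a}})

  filter-grid : ∀ {m k} → m < k → filter (_≤? m) (grid k) ≡ filter (_≤? m) (grid (suc m))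
  filter-grid {m} {k} m<k = begin
    filter (_≤? m) (concatMap (row k) (upTo k))              ≡⟨ filter-concatMap (_≤? m) (row k) (upTo k) ⟩
    concatMap (filter (_≤? m) ∘ row k) (upTo k)              ≡⟨ concatMap-cong short-rows (upTo k) ⟩
    concatMap (filter (_≤? m) ∘ row (suc m)) (upTo k)        ≡⟨ filter-concatMap (_≤? m) (row (suc m)) (upTo k) ⟨
    filter (_≤? m) (concatMap (row (suc m)) (upTo k))        ≡⟨ filter-concatMap-upTo (_≤? m) (row (suc m)) large-row m<k ⟩
    filter (_≤? m) (concatMap (row (suc m)) (upTo (suc m)))  ∎
    where
    open ≡-Reasoning
    beyond : ∀ {i t} → m < i → i < t → ¬ t ≤ m
    beyond m<i i<t = <⇒≱ (<-trans m<i i<t)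
    short-rows : ∀ a → filter (_≤? m) (row k a) ≡ filter (_≤? m) (row (suc m) a)
    short-rows a = filter-map-upTo (_≤? m) (term a) (λ m<b → beyond m<b (<-termʳ a _)) m<k
    large-row : ∀ {a} → m < a → All (∁ (_≤ m)) (row (suc m) a)
    large-row {a} m<a = AllP.map⁺ (All.universal (λ b → beyond m<a (<-termˡ a b)) (upTo (suc m)))

  terms-restrict : ∀ {m N} → m ≤ N → terms q m ≡ filter (_≤? m) (terms q N)
  terms-restrict {m} {N} m≤N = sym (begin
    filter (_≤? m) (dedup (filter (_≤? N) (grid (suc N))))
      ≡⟨ filter-deduplicate (_≤? m) _≟_ (filter (_≤? N) (grid (suc N))) ⟩
    dedup (filter (_≤? m) (filter (_≤? N) (grid (suc N))))
      ≡⟨ cong dedup (filter-filter-⊆ (_≤? m) (_≤? N) (λ x≤m → ≤-trans x≤m m≤N) (grid (suc N))) ⟩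
    dedup (filter (_≤? m) (grid (suc N)))                   ≡⟨ cong dedup (filter-grid (s≤s m≤N)) ⟩
    dedup (filter (_≤? m) (grid (suc m)))                   ∎)
    where
    open ≡-Reasoning
    dedup = deduplicate _≟_

  terms-unique : ∀ N → Unique (terms q N)
  terms-unique N = deduplicate-! (filter (_≤? N) (grid (suc N)))

  pow2∈terms : ∀ {i N} → 2 ^ i ≤ N → 2 ^ i ∈ terms q N
  pow2∈terms {i} {N} 2^i≤N =
    ∈-deduplicate⁺ _≟_ (∈-filter⁺ (_≤? N) (∈-concatMap⁺ (row (suc N)) (lose i∈exponents 2^i∈row)) 2^i≤N)
    where
    i∈exponents : i ∈ upTo (suc N)
    i∈exponents = ∈-upTo⁺ (<-≤-trans (n<m^n (s≤s (s≤s z≤n)) i) (m≤n⇒m≤1+n 2^i≤N))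
    2^i∈row : 2 ^ i ∈ row (suc N) i
    2^i∈row = subst (_∈ row (suc N) i) (*-identityʳ (2 ^ i)) (∈-map⁺ (term i) (∈-upTo⁺ z<s))

∈ᵇ-∷-≡ : ∀ x s → x ∈ᵇ (x ∷ s) ≡ true
∈ᵇ-∷-≡ x s with x ≟ x
... | yes _   = refl
... | no x≢x = ⊥-elim (x≢x refl)

∈ᵇ-∷-≢ : ∀ {x y} s → y ≢ x → y ∈ᵇ (x ∷ s) ≡ y ∈ᵇ s
∈ᵇ-∷-≢ {x} {y} s y≢x with y ≟ x
... | yes y≡x = ⊥-elim (y≢x y≡x)
... | no _    = refl

∉⇒∈ᵇ≡false : ∀ {x xs} → x ∉ xs → x ∈ᵇ xs ≡ false
∉⇒∈ᵇ≡false {xs = []} _ = refl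
∉⇒∈ᵇ≡false {xs = y ∷ ys} x∉ = trans (∈ᵇ-∷-≢ ys (x∉ ∘ here)) (∉⇒∈ᵇ≡false (x∉ ∘ there))

countB-++ : ∀ (p : A → Bool) xs ys → countB p (xs ++ ys) ≡ countB p xs + countB p ys
countB-++ p [] ys = refl
countB-++ p (x ∷ xs) ys with p x
... | true  = cong suc (countB-++ p xs ys)
... | false = countB-++ p xs ys

countB-map : ∀ (p : B → Bool) (g : A → B) xs → countB p (map g xs) ≡ countB (p ∘ g) xs
countB-map p g [] = refl
countB-map p g (x ∷ xs) with p (g x)
... | true  = cong suc (countB-map p g xs)
... | false = countB-map p g xs

countB-cong : ∀ {p p′ : A → Bool} {xs} → All (λ x → p x ≡ p′ x) xs → countB p xs ≡ countB p′ xs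
countB-cong [] = refl
countB-cong {p = p} {p′} {x ∷ xs} (px≡p′x ∷ eqs) with p x | p′ x | px≡p′x
... | true  | .true  | refl = cong suc (countB-cong eqs)
... | false | .false | refl = countB-cong eqs

countB-none : ∀ {p : A → Bool} → (∀ x → p x ≡ false) → ∀ xs → countB p xs ≡ 0
countB-none ¬p [] = refl
countB-none {p = p} ¬p (x ∷ xs) with p x | ¬p x
... | false | refl = countB-none ¬p xs

countB-sublists-∷ : ∀ (p : List A → Bool) x M →
                    countB p (sublists (x ∷ M)) ≡ countB (p ∘ (x ∷_)) (sublists M) + countB p (sublists M)
countB-sublists-∷ p x M =
  trans (countB-++ p (map (x ∷_) (sublists M)) (sublists M)) (cong (_+ countB p (sublists M)) (countB-map p (x ∷_) (sublists M)))

∈-sublists⇒⊆ : ∀ {M s : List A} → s ∈ sublists M → s ⊆ M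
∈-sublists⇒⊆ {M = []} (here refl) ()
∈-sublists⇒⊆ {M = x ∷ M} s∈ y∈s with ∈-++⁻ (map (x ∷_) (sublists M)) s∈
... | inj₂ s∈M = there (∈-sublists⇒⊆ s∈M y∈s)
... | inj₁ s∈xM with ∈-map⁻ (x ∷_) s∈xM
...   | s′ , s′∈M , refl with y∈s
...     | here y≡x = here y≡x
...     | there y∈s′ = there (∈-sublists⇒⊆ s′∈M y∈s′)

countB-sublists-filter : ∀ {P : Pred A 0ℓ} (P? : Decidable P) {p : List A → Bool} →
                         (∀ s → p s ≡ true → All P s) → ∀ M →
                         countB p (sublists M) ≡ countB p (sublists (filter P? M))
countB-sublists-filter P? bound [] = refl
countB-sublists-filter P? {p} bound (x ∷ M) with P? x
... | yes _ = begin
    countB p (sublists (x ∷ M))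
      ≡⟨ countB-sublists-∷ p x M ⟩
    countB (p ∘ (x ∷_)) (sublists M) + countB p (sublists M)
      ≡⟨ cong₂ _+_ (countB-sublists-filter P? (λ s → All.tail ∘ bound (x ∷ s)) M) (countB-sublists-filter P? bound M) ⟩
    countB (p ∘ (x ∷_)) (sublists (filter P? M)) + countB p (sublists (filter P? M))
      ≡⟨ countB-sublists-∷ p x (filter P? M) ⟨
    countB p (sublists (x ∷ filter P? M))  ∎
  where open ≡-Reasoning
... | no ¬px = begin
    countB p (sublists (x ∷ M))
      ≡⟨ countB-sublists-∷ p x M ⟩
    countB (p ∘ (x ∷_)) (sublists M) + countB p (sublists M)
      ≡⟨ cong (_+ countB p (sublists M)) (countB-none rejects-x (sublists M)) ⟩
    countB p (sublists M)
      ≡⟨ countB-sublists-filter P? bound M ⟩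
    countB p (sublists (filter P? M))  ∎
  where
  open ≡-Reasoning
  rejects-x : ∀ s → p (x ∷ s) ≡ false
  rejects-x s with p (x ∷ s) in eq
  ... | true  = ⊥-elim (¬px (All.head (bound (x ∷ s) eq)))
  ... | false = refl

-- Counting subsets with required and forbidden elements

data Status : Set where
  required forbidden optional : Status

dual : Status → Status
dual required  = forbidden
dual forbidden = required
dual optional  = optional

admits : Status → Bool → Bool
admits required  b = b
admits forbidden b = not b
admits optional  _ = true

mass : Status → ℕ → ℕ
mass required  x = x
mass forbidden _ = 0
mass optional  _ = 0

branch : Status → ℕ → ℕ → ℕ
branch required  u _ = u
branch forbidden _ v = v
branch optional  u v = u + v

respects : (ℕ → Status) → List ℕ → List ℕ → Bool
respects σ M s = all (λ y → admits (σ y) (y ∈ᵇ s)) M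

-- The offset a accumulates the elements already chosen when M is peeled off one element at a time.
count : (ℕ → Status) → List ℕ → ℕ → ℕ → ℕ
count σ M a n = countB (λ s → ⌊ a + sum s ≟ n ⌋ ∧ respects σ M s) (sublists M)

weight : (ℕ → Status) → List ℕ → ℕ
weight σ M = sum (map (λ y → mass (σ y) y) M)

_[_↦_] : (ℕ → Status) → ℕ → Status → ℕ → Status
(σ [ x ↦ st ]) y with y ≟ x
... | yes _ = st
... | no _  = σ y

update-≡ : ∀ σ x st → (σ [ x ↦ st ]) x ≡ st
update-≡ σ x st with x ≟ x
... | yes _   = refl
... | no x≢x = ⊥-elim (x≢x refl)

update-≢ : ∀ σ {x y} st → y ≢ x → (σ [ x ↦ st ]) y ≡ σ y
update-≢ σ {x} {y} st y≢x with y ≟ x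
... | yes y≡x = ⊥-elim (y≢x y≡x)
... | no _    = refl

head∉tail : ∀ {x : A} {M} → Unique (x ∷ M) → x ∉ M
head∉tail (x≢M ∷ _) = AllP.All¬⇒¬Any x≢M

∈-tail⇒≢head : ∀ {x y : A} {M} → Unique (x ∷ M) → y ∈ M → y ≢ x
∈-tail⇒≢head u y∈M refl = head∉tail u y∈M

respects-cong : ∀ {σ τ M} → (∀ {y} → y ∈ M → σ y ≡ τ y) → ∀ s → respects σ M s ≡ respects τ M s
respects-cong σ≗τ s =
  cong and (map-cong-local (All.tabulate (λ {y} y∈M → cong (λ st → admits st (y ∈ᵇ s)) (σ≗τ y∈M))))

count-cong : ∀ {σ τ} M → (∀ {y} → y ∈ M → σ y ≡ τ y) → ∀ a n → count σ M a n ≡ count τ M a n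
count-cong M σ≗τ a n =
  countB-cong (All.universal (λ s → cong (⌊ a + sum s ≟ n ⌋ ∧_) (respects-cong σ≗τ s)) (sublists M))

weight-cong : ∀ {σ τ} M → (∀ {y} → y ∈ M → σ y ≡ τ y) → weight σ M ≡ weight τ M
weight-cong M σ≗τ = cong sum (map-cong-local (All.tabulate (λ {y} y∈M → cong (λ st → mass st y) (σ≗τ y∈M))))

respects-∷ : ∀ σ {x M} → x ∉ M → ∀ s → respects σ M (x ∷ s) ≡ respects σ M s
respects-∷ σ {x} {M} x∉M s = cong and (map-cong-local (All.tabulate y≢x))
  where
  y≢x : ∀ {y} → y ∈ M → admits (σ y) (y ∈ᵇ (x ∷ s)) ≡ admits (σ y) (y ∈ᵇ s)
  y≢x y∈M = cong (admits (σ _)) (∈ᵇ-∷-≢ s (λ { refl → x∉M y∈M }))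

countB-guarded : ∀ st (e e′ r : List ℕ → Bool) xs →
                 countB (λ s → e s ∧ (admits st true ∧ r s)) xs + countB (λ s → e′ s ∧ (admits st false ∧ r s)) xs
                   ≡ branch st (countB (λ s → e s ∧ r s) xs) (countB (λ s → e′ s ∧ r s) xs)
countB-guarded required  e e′ r xs =
  trans (cong (countB (λ s → e s ∧ r s) xs +_) (countB-none (λ s → ∧-zeroʳ (e′ s)) xs)) (+-identityʳ _)
countB-guarded forbidden e e′ r xs = cong (_+ countB (λ s → e′ s ∧ r s) xs) (countB-none (λ s → ∧-zeroʳ (e s)) xs)
countB-guarded optional  e e′ r xs = refl

count-∷ : ∀ σ {x M st} → σ x ≡ st → x ∉ M → ∀ a n →
          count σ (x ∷ M) a n ≡ branch st (count σ M (a + x) n) (count σ M a n)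
count-∷ σ {x} {M} refl x∉M a n = begin
  countB P (sublists (x ∷ M))
    ≡⟨ countB-sublists-∷ P x M ⟩
  countB (P ∘ (x ∷_)) (sublists M) + countB P (sublists M)
    ≡⟨ cong₂ _+_ (countB-cong (All.universal with-x (sublists M))) (countB-cong (All.tabulate without-x)) ⟩
  countB (λ s → sum-is (a + x) s ∧ (admits (σ x) true ∧ respects σ M s)) (sublists M)
    + countB (λ s → sum-is a s ∧ (admits (σ x) false ∧ respects σ M s)) (sublists M)
    ≡⟨ countB-guarded (σ x) (sum-is (a + x)) (sum-is a) (respects σ M) (sublists M) ⟩
  branch (σ x) (count σ M (a + x) n) (count σ M a n)  ∎
  where
  open ≡-Reasoning
  sum-is : ℕ → List ℕ → Bool
  sum-is b s = ⌊ b + sum s ≟ n ⌋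
  P : List ℕ → Bool
  P s = sum-is a s ∧ respects σ (x ∷ M) s
  with-x : ∀ s → P (x ∷ s) ≡ sum-is (a + x) s ∧ (admits (σ x) true ∧ respects σ M s)
  with-x s = cong₂ (λ b c → ⌊ b ≟ n ⌋ ∧ c) (sym (+-assoc a x (sum s)))
                   (cong₂ _∧_ (cong (admits (σ x)) (∈ᵇ-∷-≡ x s)) (respects-∷ σ x∉M s))
  without-x : ∀ {s} → s ∈ sublists M → P s ≡ sum-is a s ∧ (admits (σ x) false ∧ respects σ M s)
  without-x {s} s∈ =
    cong (λ b → sum-is a s ∧ (admits (σ x) b ∧ respects σ M s)) (∉⇒∈ᵇ≡false (x∉M ∘ ∈-sublists⇒⊆ s∈))

+-balance : ∀ {b b′ m m′} → b + m′ ≡ b′ + m → b ≡ m → b′ ≡ m′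
+-balance {b} {b′} {m′ = m′} eq refl = sym (+-cancelˡ-≡ b m′ b′ (trans eq (+-comm b′ b)))

+-rotate : ∀ a x w m → a + x + w + m ≡ x + (a + w + m)
+-rotate = solve-∀

-- The involution behind this identity is S ↦ S Δ {y ∈ M : σ y ≠ optional}: it exchanges the roles of
-- required and forbidden elements and changes the sum by weight (dual ∘ σ) M − weight σ M.
count-dual : ∀ σ {M} → Unique M → ∀ {a a′ n n′} → a + weight σ M + n′ ≡ a′ + weight (dual ∘ σ) M + n →
             count σ M a n ≡ count (dual ∘ σ) M a′ n′
count-dual σ {[]} [] {a} {a′} {n} {n′} balanced with a + 0 ≟ n | a′ + 0 ≟ n′
... | yes _    | yes _    = refl
... | no _     | no _     = refl
... | yes a≡n  | no a′≢n′ = ⊥-elim (a′≢n′ (+-balance balanced a≡n))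
... | no a≢n   | yes a′≡n′ = ⊥-elim (a≢n (+-balance (sym balanced) a′≡n′))
count-dual σ {x ∷ M} u@(_ ∷ uM) {a} {a′} {n} {n′} balanced = begin
  count σ (x ∷ M) a n
    ≡⟨ count-∷ σ refl (head∉tail u) a n ⟩
  branch (σ x) (count σ M (a + x) n) (count σ M a n)
    ≡⟨ by-status (σ x) balanced ⟩
  branch (dual (σ x)) (count (dual ∘ σ) M (a′ + x) n′) (count (dual ∘ σ) M a′ n′)
    ≡⟨ count-∷ (dual ∘ σ) refl (head∉tail u) a′ n′ ⟨
  count (dual ∘ σ) (x ∷ M) a′ n′  ∎
  where
  open ≡-Reasoning
  w = weight σ M
  w′ = weight (dual ∘ σ) M
  by-status : ∀ st → a + (mass st x + w) + n′ ≡ a′ + (mass (dual st) x + w′) + n →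
              branch st (count σ M (a + x) n) (count σ M a n)
                ≡ branch (dual st) (count (dual ∘ σ) M (a′ + x) n′) (count (dual ∘ σ) M a′ n′)
  by-status required  eq = count-dual σ uM (trans (cong (_+ n′) (+-assoc a x w)) eq)
  by-status forbidden eq = count-dual σ uM (trans eq (cong (_+ n) (sym (+-assoc a′ x w′))))
  by-status optional  eq = cong₂ _+_
    (count-dual σ uM (trans (+-rotate a x w n′) (trans (cong (x +_) eq) (sym (+-rotate a′ x w′ n)))))
    (count-dual σ uM eq)

branch-+ : ∀ st {u u′ v v′} → branch st (u + u′) (v + v′) ≡ branch st u v + branch st u′ v′
branch-+ required  = refl
branch-+ forbidden = refl
branch-+ optional {u} {u′} {v} {v′} = +-interchange u u′ v v′

count-split : ∀ σ {x M} → x ∈ M → Unique M → σ x ≡ optional → ∀ a n →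
              count σ M a n ≡ count (σ [ x ↦ required ]) M a n + count (σ [ x ↦ forbidden ]) M a n
count-split σ {x} {x ∷ M} (here refl) u σx≡optional a n = begin
  count σ (x ∷ M) a n
    ≡⟨ count-∷ σ σx≡optional x∉M a n ⟩
  count σ M (a + x) n + count σ M a n
    ≡⟨ cong₂ _+_ (count-cong M (agrees required) (a + x) n) (count-cong M (agrees forbidden) a n) ⟨
  count σʳ M (a + x) n + count σᶠ M a n
    ≡⟨ cong₂ _+_ (count-∷ σʳ (update-≡ σ x required) x∉M a n) (count-∷ σᶠ (update-≡ σ x forbidden) x∉M a n) ⟨
  count σʳ (x ∷ M) a n + count σᶠ (x ∷ M) a n  ∎
  where
  open ≡-Reasoning
  x∉M = head∉tail u
  σʳ = σ [ x ↦ required ]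
  σᶠ = σ [ x ↦ forbidden ]
  agrees : ∀ st {y} → y ∈ M → (σ [ x ↦ st ]) y ≡ σ y
  agrees st y∈M = update-≢ σ st (∈-tail⇒≢head u y∈M)
count-split σ {x} {y ∷ M} (there x∈M) u@(_ ∷ uM) σx≡optional a n = begin
  count σ (y ∷ M) a n
    ≡⟨ count-∷ σ refl y∉M a n ⟩
  branch (σ y) (count σ M (a + y) n) (count σ M a n)
    ≡⟨ cong₂ (branch (σ y)) (count-split σ x∈M uM σx≡optional (a + y) n) (count-split σ x∈M uM σx≡optional a n) ⟩
  branch (σ y) (count σʳ M (a + y) n + count σᶠ M (a + y) n) (count σʳ M a n + count σᶠ M a n)
    ≡⟨ branch-+ (σ y) ⟩
  branch (σ y) (count σʳ M (a + y) n) (count σʳ M a n) + branch (σ y) (count σᶠ M (a + y) n) (count σᶠ M a n)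
    ≡⟨ cong₂ _+_ (count-∷ σʳ (update-≢ σ required y≢x) y∉M a n)
                 (count-∷ σᶠ (update-≢ σ forbidden y≢x) y∉M a n) ⟨
  count σʳ (y ∷ M) a n + count σᶠ (y ∷ M) a n  ∎
  where
  open ≡-Reasoning
  y∉M = head∉tail u
  y≢x = ≢-sym (∈-tail⇒≢head u x∈M)
  σʳ = σ [ x ↦ required ]
  σᶠ = σ [ x ↦ forbidden ]

weight-none : ∀ σ M → (∀ y → mass (σ y) y ≡ 0) → weight σ M ≡ 0
weight-none σ [] _ = refl
weight-none σ (y ∷ M) massless = cong₂ _+_ (massless y) (weight-none σ M massless)

weight-update : ∀ σ {x M} st → x ∈ M → Unique M → σ x ≡ optional → weight (σ [ x ↦ st ]) M ≡ mass st x + weight σ M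
weight-update σ {x} {x ∷ M} st (here refl) u σx≡optional = begin
  mass ((σ [ x ↦ st ]) x) x + weight (σ [ x ↦ st ]) M
    ≡⟨ cong₂ _+_ (cong (λ st′ → mass st′ x) (update-≡ σ x st))
                 (weight-cong M (λ y∈M → update-≢ σ st (∈-tail⇒≢head u y∈M))) ⟩
  mass st x + weight σ M
    ≡⟨ cong (λ st′ → mass st x + (mass st′ x + weight σ M)) σx≡optional ⟨
  mass st x + (mass (σ x) x + weight σ M)  ∎
  where open ≡-Reasoning
weight-update σ {x} {y ∷ M} st (there x∈M) u@(_ ∷ uM) σx≡optional = begin
  mass ((σ [ x ↦ st ]) y) y + weight (σ [ x ↦ st ]) M
    ≡⟨ cong₂ _+_ (cong (λ st′ → mass st′ y) (update-≢ σ st y≢x)) (weight-update σ st x∈M uM σx≡optional) ⟩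
  mass (σ y) y + (mass st x + weight σ M)
    ≡⟨ +-exchange (mass (σ y) y) (mass st x) (weight σ M) ⟩
  mass st x + (mass (σ y) y + weight σ M)  ∎
  where
  open ≡-Reasoning
  y≢x = ≢-sym (∈-tail⇒≢head u x∈M)

onList : List ℕ → Status → ℕ → Status
onList R st y with y ∈? R
... | yes _ = st
... | no _  = optional

onList-∈ : ∀ {R} st {y} → y ∈ R → onList R st y ≡ st
onList-∈ {R} st {y} y∈R with y ∈? R
... | yes _   = refl
... | no y∉R = ⊥-elim (y∉R y∈R)

onList-∉ : ∀ {R} st {y} → y ∉ R → onList R st y ≡ optional
onList-∉ {R} st {y} y∉R with y ∈? R
... | yes y∈R = ⊥-elim (y∉R y∈R)
... | no _    = refl

onList-∷ʳ : ∀ R x st y → onList (R ∷ʳ x) st y ≡ (onList R st [ x ↦ st ]) y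
onList-∷ʳ R x st y with y ≟ x
... | yes refl = onList-∈ st (∈-++⁺ʳ R (here refl))
... | no y≢x with y ∈? R
...   | yes y∈R = onList-∈ st (∈-++⁺ˡ y∈R)
...   | no y∉R  = onList-∉ st (λ y∈ → [ y∉R , (λ { (here y≡x) → y≢x y≡x }) ]′ (∈-++⁻ R y∈))

dual-onList : ∀ R st y → dual (onList R st y) ≡ onList R (dual st) y
dual-onList R st y with y ∈? R
... | yes _ = refl
... | no _  = refl

mass-onList-forbidden : ∀ R y → mass (onList R forbidden y) y ≡ 0
mass-onList-forbidden R y with y ∈? R
... | yes _ = refl
... | no _  = refl

T-extensional : ∀ {a b} → (T a → T b) → (T b → T a) → a ≡ b
T-extensional {false} {false} _ _ = refl
T-extensional {false} {true}  _ b⇒a = ⊥-elim (b⇒a tt)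
T-extensional {true}  {false} a⇒b _ = ⊥-elim (a⇒b tt)
T-extensional {true}  {true}  _ _ = refl

respects-onList : ∀ R st {M} → R ⊆ M → ∀ s → all (λ r → admits st (r ∈ᵇ s)) R ≡ respects (onList R st) M s
respects-onList R st {M} R⊆M s = T-extensional
  (λ allR → AllP.all⁻ _ {M} (All.tabulate (λ {y} _ → at y (AllP.all⁺ _ R allR))))
  (λ allM → AllP.all⁻ _ {R} (All.tabulate (λ {r} r∈R →
     subst (λ st′ → T (admits st′ (r ∈ᵇ s))) (onList-∈ st r∈R) (All.lookup (AllP.all⁺ _ M allM) (R⊆M r∈R)))))
  where
  at : ∀ y → All (λ r → T (admits st (r ∈ᵇ s))) R → T (admits (onList R st y) (y ∈ᵇ s))
  at y allR with y ∈? R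
  ... | yes y∈R = All.lookup allR y∈R
  ... | no _    = tt

powers : ℕ → List ℕ
powers k = map (2 ^_) (upTo k)

powers-suc : ∀ k → powers (suc k) ≡ powers k ∷ʳ 2 ^ k
powers-suc k = trans (cong (map (2 ^_)) (sym (upTo-∷ʳ k))) (map-++ (2 ^_) (upTo k) [ k ])

∈-powers⁻ : ∀ {k x} → x ∈ powers k → ∃[ i ] i < k × x ≡ 2 ^ i
∈-powers⁻ x∈ with ∈-map⁻ (2 ^_) x∈
... | i , i∈ , x≡2^i = i , ∈-upTo⁻ i∈ , x≡2^i

∈-powers⁺ : ∀ {i k} → i < k → 2 ^ i ∈ powers k
∈-powers⁺ i<k = ∈-map⁺ (2 ^_) (∈-upTo⁺ i<k)

powers-⊆-suc : ∀ k → powers k ⊆ powers (suc k)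
powers-⊆-suc k x∈ with ∈-powers⁻ x∈
... | i , i<k , refl = ∈-powers⁺ (m<n⇒m<1+n i<k)

2^k∉powers : ∀ k → 2 ^ k ∉ powers k
2^k∉powers k 2^k∈ with ∈-powers⁻ 2^k∈
... | i , i<k , 2^k≡2^i = <-irrefl (sym 2^k≡2^i) (^-monoʳ-< 2 (s≤s (s≤s z≤n)) i<k)

onList-powers-suc : ∀ k st y → onList (powers (suc k)) st y ≡ (onList (powers k) st [ 2 ^ k ↦ st ]) y
onList-powers-suc k st y = trans (cong (λ R → onList R st y) (powers-suc k)) (onList-∷ʳ (powers k) (2 ^ k) st y)

weight-powers : ∀ {M} → Unique M → ∀ k → powers k ⊆ M → suc (weight (onList (powers k) required) M) ≡ 2 ^ k
weight-powers {M} uM zero _ = cong suc (weight-none (onList [] required) M (λ _ → refl))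
weight-powers {M} uM (suc k) powers⊆M = begin
  suc (weight (onList (powers (suc k)) required) M)
    ≡⟨ cong suc (weight-cong M (λ {y} _ → onList-powers-suc k required y)) ⟩
  suc (weight (τ [ 2 ^ k ↦ required ]) M)
    ≡⟨ cong suc (weight-update τ required (powers⊆M (∈-powers⁺ (n<1+n k))) uM (onList-∉ required (2^k∉powers k))) ⟩
  suc (2 ^ k + weight τ M)
    ≡⟨ +-suc (2 ^ k) (weight τ M) ⟨
  2 ^ k + suc (weight τ M)
    ≡⟨ cong (2 ^ k +_) (weight-powers uM k (powers⊆M ∘ powers-⊆-suc k)) ⟩
  2 ^ k + 2 ^ k
    ≡⟨ cong (2 ^ k +_) (+-identityʳ (2 ^ k)) ⟨
  2 ^ suc k  ∎
  where
  open ≡-Reasoning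
  τ = onList (powers k) required

-- Expressions as constrained subsets of the terms

All-≤-sum : ∀ s → All (_≤ sum s) s
All-≤-sum [] = []
All-≤-sum (x ∷ s) = m≤m+n x (sum s) ∷ All.map (λ y≤ → ≤-trans y≤ (m≤n+m (sum s) x)) (All-≤-sum s)

fWith-restrict : ∀ q → 1 < q → ∀ (p : List ℕ → Bool) {m N} → m ≤ N →
                 fWith q p m ≡ countB (λ s → ⌊ sum s ≟ m ⌋ ∧ p s) (sublists (terms q N))
fWith-restrict q 1<q p {m} {N} m≤N =
  trans (cong (countB P ∘ sublists) (terms-restrict m≤N)) (sym (countB-sublists-filter (_≤? m) bounded (terms q N)))
  where
  open Terms q 1<q
  P : List ℕ → Bool
  P s = ⌊ sum s ≟ m ⌋ ∧ p s
  bounded : ∀ s → P s ≡ true → All (_≤ m) s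
  bounded s Ps with sum s ≟ m
  ... | yes refl = All-≤-sum s
  ... | no _ = case Ps of λ ()

fWith-as-count : ∀ q → 1 < q → ∀ R st {m N} → m ≤ N → R ⊆ terms q N →
                 fWith q (λ s → all (λ r → admits st (r ∈ᵇ s)) R) m ≡ count (onList R st) (terms q N) 0 m
fWith-as-count q 1<q R st {m} {N} m≤N R⊆U = trans (fWith-restrict q 1<q _ m≤N)
  (countB-cong (All.universal (λ s → cong (⌊ sum s ≟ m ⌋ ∧_) (respects-onList R st R⊆U s)) (sublists (terms q N))))

module Expressions (q : ℕ) (1<q : 1 < q) (n t : ℕ) where

  open Terms q 1<q using (terms-unique; pow2∈terms)

  -- Large enough to compute f at n and n + 1, and to contain 2^0, …, 2^t.
  U : List ℕ
  U = terms q (2 ^ t + n)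

  ways : (ℕ → Status) → ℕ → ℕ
  ways σ m = count σ U 0 m

  powers⊆U : ∀ {k} → k ≤ suc t → powers k ⊆ U
  powers⊆U k≤1+t x∈ with ∈-powers⁻ x∈
  ... | i , i<k , refl = pow2∈terms {i} (≤-trans (^-monoʳ-≤ 2 (≤-pred (≤-trans i<k k≤1+t))) (m≤m+n (2 ^ t) n))

  fWith-as-ways : ∀ R st {m} → m ≤ suc n → R ⊆ U →
                  fWith q (λ s → all (λ r → admits st (r ∈ᵇ s)) R) m ≡ ways (onList R st) m
  fWith-as-ways R st m≤1+n = fWith-as-count q 1<q R st (≤-trans m≤1+n (+-monoˡ-≤ n (m^n>0 2 t)))

  module Step (k : ℕ) (k≤t : k ≤ t) where

    τ φ : ℕ → Status
    τ = onList (powers k) required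
    φ = onList (powers k) forbidden

    2^k∈U : 2 ^ k ∈ U
    2^k∈U = powers⊆U (s≤s k≤t) (∈-powers⁺ (n<1+n k))

    U-unique : Unique U
    U-unique = terms-unique (2 ^ t + n)

    dual-φʳ : ∀ y → dual ((φ [ 2 ^ k ↦ required ]) y) ≡ (τ [ 2 ^ k ↦ forbidden ]) y
    dual-φʳ y with y ≟ 2 ^ k
    ... | yes _ = refl
    ... | no _  = dual-onList (powers k) forbidden y

    weight-φʳ : weight (φ [ 2 ^ k ↦ required ]) U ≡ 2 ^ k + 0
    weight-φʳ = trans (weight-update φ required 2^k∈U U-unique (onList-∉ forbidden (2^k∉powers k)))
                      (cong (2 ^ k +_) (weight-none φ U (mass-onList-forbidden (powers k))))

    weight-τᶠ : suc (weight (τ [ 2 ^ k ↦ forbidden ]) U) ≡ 2 ^ k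
    weight-τᶠ = trans (cong suc (weight-update τ forbidden 2^k∈U U-unique (onList-∉ required (2^k∉powers k))))
                      (weight-powers U-unique k (powers⊆U (m≤n⇒m≤1+n k≤t)))

    exchange : ways (φ [ 2 ^ k ↦ required ]) (suc n) ≡ ways (τ [ 2 ^ k ↦ forbidden ]) n
    exchange = trans (count-dual (φ [ 2 ^ k ↦ required ]) U-unique balanced) (count-cong U (λ {y} _ → dual-φʳ y) 0 n)
      where
      open ≡-Reasoning
      w = weight (τ [ 2 ^ k ↦ forbidden ]) U
      balanced : weight (φ [ 2 ^ k ↦ required ]) U + n ≡ weight (dual ∘ (φ [ 2 ^ k ↦ required ])) U + suc n
      balanced = begin
        weight (φ [ 2 ^ k ↦ required ]) U + n              ≡⟨ cong (_+ n) (trans weight-φʳ (+-identityʳ (2 ^ k))) ⟩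
        2 ^ k + n                                           ≡⟨ cong (_+ n) weight-τᶠ ⟨
        suc w + n                                           ≡⟨ +-suc w n ⟨
        w + suc n                                           ≡⟨ cong (_+ suc n) (weight-cong U (λ {y} _ → dual-φʳ y)) ⟨
        weight (dual ∘ (φ [ 2 ^ k ↦ required ])) U + suc n  ∎

    split-τ : ways τ n ≡ ways (onList (powers (suc k)) required) n + ways (τ [ 2 ^ k ↦ forbidden ]) n
    split-τ = trans (count-split τ 2^k∈U U-unique (onList-∉ required (2^k∉powers k)) 0 n)
                    (cong (_+ ways (τ [ 2 ^ k ↦ forbidden ]) n) (count-cong U (λ {y} _ → sym (onList-powers-suc k required y)) 0 n))

    split-φ : ways φ (suc n) ≡ ways (τ [ 2 ^ k ↦ forbidden ]) n + ways (onList (powers (suc k)) forbidden) (suc n)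
    split-φ = trans (count-split φ 2^k∈U U-unique (onList-∉ forbidden (2^k∉powers k)) 0 (suc n))
                    (cong₂ _+_ exchange (count-cong U (λ {y} _ → sym (onList-powers-suc k forbidden y)) 0 (suc n)))

  unconstrained : ℕ → Status
  unconstrained _ = optional

  ways-difference : ∀ k → k ≤ suc t →
          ways unconstrained (suc n) + ways (onList (powers k) required) n
            ≡ ways unconstrained n + ways (onList (powers k) forbidden) (suc n)
  ways-difference zero _ = +-comm (ways unconstrained (suc n)) (ways unconstrained n)
  ways-difference (suc k) (s≤s k≤t) = +-cancelʳ-≡ D (E₁ + T′) (E₀ + F′) (begin
    E₁ + T′ + D          ≡⟨ +-assoc E₁ T′ D ⟩
    E₁ + (T′ + D)        ≡⟨ cong (E₁ +_) split-τ ⟨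
    E₁ + ways τ n        ≡⟨ ways-difference k (m≤n⇒m≤1+n k≤t) ⟩
    E₀ + ways φ (suc n)  ≡⟨ cong (E₀ +_) (trans split-φ (+-comm D F′)) ⟩
    E₀ + (F′ + D)        ≡⟨ +-assoc E₀ F′ D ⟨
    E₀ + F′ + D          ∎)
    where
    open ≡-Reasoning
    open Step k k≤t
    E₁ = ways unconstrained (suc n)
    E₀ = ways unconstrained n
    T′ = ways (onList (powers (suc k)) required) n
    F′ = ways (onList (powers (suc k)) forbidden) (suc n)
    D = ways (τ [ 2 ^ k ↦ forbidden ]) n

  difference-identity : f q (suc n) + fIncl q (powers2 t) n ≡ f q n + fExcl q (powers2 t) (suc n)
  difference-identity = begin
    f q (suc n) + fIncl q (powers2 t) n
      ≡⟨ cong₂ _+_ (fWith-as-ways [] required ≤-refl (λ ()))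
                   (fWith-as-ways (powers (suc t)) required (n≤1+n n) (powers⊆U ≤-refl)) ⟩
    ways unconstrained (suc n) + ways (onList (powers (suc t)) required) n
      ≡⟨ ways-difference (suc t) ≤-refl ⟩
    ways unconstrained n + ways (onList (powers (suc t)) forbidden) (suc n)
      ≡⟨ cong₂ _+_ (fWith-as-ways [] required (n≤1+n n) (λ ()))
                   (fWith-as-ways (powers (suc t)) forbidden ≤-refl (powers⊆U ≤-refl)) ⟨
    f q n + fExcl q (powers2 t) (suc n)  ∎
    where open ≡-Reasoning

[+a]-[+b]≡[+c]-[+d] : ∀ {a b c d} → a + d ≡ b + c → ℤ.+ a ℤ.- ℤ.+ b ≡ ℤ.+ c ℤ.- ℤ.+ d
[+a]-[+b]≡[+c]-[+d] {a} {b} {c} {d} a+d≡b+c = begin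
  ℤ.+ a ℤ.- ℤ.+ b    ≡⟨ [+m]-[+n]≡m⊖n a b ⟩
  a ⊖ b              ≡⟨ +-cancelˡ-⊖ d a b ⟨
  (d + a) ⊖ (d + b)  ≡⟨ cong₂ _⊖_ (trans (+-comm d a) a+d≡b+c) (+-comm d b) ⟩
  (b + c) ⊖ (b + d)  ≡⟨ +-cancelˡ-⊖ b c d ⟩
  c ⊖ d              ≡⟨ [+m]-[+n]≡m⊖n c d ⟨
  ℤ.+ c ℤ.- ℤ.+ d    ∎
  where open ≡-Reasoning

open ℤ using (+_; _-_)

lemma3 : (q : ℕ) → 2 < q → ¬ (2 ∣ q) → (t n : ℕ) → 1 ≤ n →
    (+ f q (suc n)) - (+ f q n)
    ≡ (+ fExcl q (powers2 t) (suc n)) - (+ fIncl q (powers2 t) n)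
lemma3 q 2<q _ t n _ =
  [+a]-[+b]≡[+c]-[+d] {f q (suc n)} {f q n} {fExcl q (powers2 t) (suc n)} {fIncl q (powers2 t) n}
    (Expressions.difference-identity q (<⇒≤ 2<q) n t)
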